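{- Let $G$ be a finite graph on $n$ vertices and $k$ a natural number, and let $\mathcal{B}$ be either $\mathcal{B}(G)$, or $\mathcal{B}_{\geq k}(G)$ with $k\le n-1$. Let $P\in V(\mathcal{B})$. If $P$ has a part of size at least $4$, then $P$ does not satisfy Property 1.
   Context: An independent set partition of $G$ is a partition of $V(G)$ into nonempty independent sets (parts). For such a partition $P$ and $v\in V(G)$, let $P-v$ be the partition of $V(G)\setminus\{v\}$ obtained by deleting $v$ from its part (discarding that part if empty). The Bell colouring graph $\mathcal{B}(G)$ has as vertices the independent set partitions of $G$, with $P\neq Q$ adjacent iff $P-v=Q-v$ for some $v\in V(G)$; $\mathcal{B}_{\geq k}(G)$ is its induced subgraph on partitions with at least $k$ parts. For $P\in V(\mathcal{B})$, $N(P)$ is its set of neighbours in $\mathcal{B}$ and $N[P]=N(P)\cup\{P\}$. Property 1 (of $P$ in $\mathcal{B}$): any two neighbours of $P$ which are not adjacent to each other have exactly one common neighbour $R$ in $\mathcal{B}$ outside $N[P]$, and no other neighbour of $P$ is adjacent to $R$. -}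

module Defs where

open import Data.Nat using (ℕ; zero; suc; _+_; _≤_)
open import Data.Fin using (Fin; zero; suc; _<_)
open import Data.Bool using (Bool; true; false; if_then_else_)
open import Data.Product using (Σ; ∃; _×_; _,_)
open import Data.Sum using (_⊎_)
open import Data.Unit using (⊤)
open import Relation.Nullary using (¬_)
open import Relation.Binary.PropositionalEquality using (_≡_; _≢_)

record Graph (n : ℕ) : Set where
  field
    adj   : Fin n → Fin n → Bool
    sym   : ∀ u v → adj u v ≡ adj v u
    irrefl : ∀ v → adj v v ≡ false
open Graph public

-- An independent set partition of V(G), represented by its "same part"
-- equivalence relation (all parts are automatically nonempty), whose
-- classes are independent sets.
record ISPartition {n : ℕ} (G : Graph n) : Set where
  field
    same      : Fin n → Fin n → Bool
    same-refl  : ∀ v → same v v ≡ true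
    same-sym   : ∀ u v → same u v ≡ same v u
    same-trans : ∀ u v w → same u v ≡ true → same v w ≡ true → same u w ≡ true
    indep      : ∀ u v → same u v ≡ true → adj G u v ≡ false
open ISPartition public

_≈P_ : ∀ {n} {G : Graph n} → ISPartition G → ISPartition G → Set
P ≈P Q = ∀ u w → same P u w ≡ same Q u w

EqMinus : ∀ {n} {G : Graph n} → ISPartition G → ISPartition G → Fin n → Set
EqMinus P Q v = ∀ u w → u ≢ v → w ≢ v → same P u w ≡ same Q u w

BAdj : ∀ {n} {G : Graph n} → ISPartition G → ISPartition G → Set
BAdj P Q = ¬ (P ≈P Q) × ∃ λ v → EqMinus P Q v

count : ∀ {n} → (Fin n → Bool) → ℕ
count {zero}  f = 0
count {suc n} f = (if f zero then 1 else 0) + count (λ i → f (suc i))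

allB : ∀ {n} → (Fin n → Bool) → Bool
allB {zero}  f = true
allB {suc n} f = if f zero then allB (λ i → f (suc i)) else false

_<ᵇF_ : ∀ {n} → Fin n → Fin n → Bool
zero  <ᵇF zero  = false
zero  <ᵇF suc _ = true
suc _ <ᵇF zero  = false
suc a <ᵇF suc b = a <ᵇF b

-- v is the least vertex of its part
isLeader : ∀ {n} {G : Graph n} → ISPartition G → Fin n → Bool
isLeader P v = allB (λ u → if u <ᵇF v then (if same P u v then false else true) else true)

numParts : ∀ {n} {G : Graph n} → ISPartition G → ℕ
numParts P = count (isLeader P)

partSize : ∀ {n} {G : Graph n} → ISPartition G → Fin n → ℕ
partSize P v = count (same P v)

HasPartOfSize≥4 : ∀ {n} {G : Graph n} → ISPartition G → Set
HasPartOfSize≥4 P = ∃ λ v → 4 ≤ partSize P v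

-- Property 1 of P in the induced subgraph of B(G) on the partitions
-- satisfying the predicate `InB`.
Property1 : ∀ {n} {G : Graph n} → (ISPartition G → Set) → ISPartition G → Set
Property1 {G = G} InB P =
  ∀ (Q₁ Q₂ : ISPartition G) → InB Q₁ → InB Q₂ →
  BAdj P Q₁ → BAdj P Q₂ → ¬ (Q₁ ≈P Q₂) → ¬ BAdj Q₁ Q₂ →
  Σ (ISPartition G) λ R →
    InB R × ¬ (R ≈P P) × ¬ BAdj P R × BAdj Q₁ R × BAdj Q₂ R
    × (∀ (R' : ISPartition G) → InB R' → ¬ (R' ≈P P) → ¬ BAdj P R' →
         BAdj Q₁ R' → BAdj Q₂ R' → R' ≈P R)
    × (∀ (Q : ISPartition G) → InB Q → BAdj P Q → BAdj Q R →
         (Q ≈P Q₁) ⊎ (Q ≈P Q₂))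

InBAll : ∀ {n} {G : Graph n} → ISPartition G → Set
InBAll P = ⊤

InB≥ : ∀ {n} {G : Graph n} → ℕ → ISPartition G → Set
InB≥ k P = k ≤ numParts P

-- Let a, b, c, d be distinct vertices of one part of P. Splitting a, resp. b, off that
-- part gives neighbours Q₁, Q₂ of P. Both R₁ (a and b split off as two singletons) and
-- R₂ ({a, b} split off) are common neighbours of Q₁ and Q₂ lying outside N[P], so the
-- common neighbour demanded by Property 1 is not unique. Non-adjacency (of Q₁ and Q₂, and
-- of P and Rᵢ) holds because the two partitions disagree on the disjoint pairs {a, c} and
-- {b, d}, which no single vertex deletion can repair. All these partitions refine P, so
-- they lie in B≥k whenever P does.
{-# OPTIONS --safe #-}
module Submission where

open import Defs
open import Data.Nat using (ℕ; zero; suc; _≤_; _∸_; z≤n; s≤s; s≤s⁻¹)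
open import Data.Nat.Properties using (_≟_; ≤-trans; m≤n⇒m≤o+n)
open import Data.Fin using (Fin; zero; suc)
open import Data.Fin.Properties using () renaming (_≟_ to _≟ᶠ_)
open import Data.Bool using (Bool; true; false; _∧_; not; if_then_else_)
open import Data.Bool.Properties using (∧-identityʳ; ∧-conicalˡ; ∧-conicalʳ; not-¬)
open import Data.Product using (_×_; ∃; _,_)
open import Data.Sum using (_⊎_; inj₁; inj₂)
open import Data.Unit using (tt)
open import Function using (_∘_; mk⇔)
open import Relation.Nullary using (¬_; Dec; yes; no; does; contradiction)
open import Relation.Nullary.Decidable using (dec-true; dec-false; does-⇔)
open import Relation.Binary.PropositionalEquality
  using (_≡_; _≢_; refl; trans; cong; cong₂; ≢-sym) renaming (sym to ≡-sym)

does-true⇒ : ∀ {A : Set} (a? : Dec A) → does a? ≡ true → A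
does-true⇒ (yes a) _ = a

≟-swap : ∀ m n → does (m ≟ n) ≡ does (n ≟ m)
≟-swap m n = does-⇔ (mk⇔ ≡-sym ≡-sym) (m ≟ n) (n ≟ m)

same-kernel-on-pair : ∀ {A : Set} {s t x y : A} (f g : A → ℕ) →
  does (f s ≟ f t) ≡ does (g s ≟ g t) →
  x ≡ s ⊎ x ≡ t → y ≡ s ⊎ y ≡ t → does (f x ≟ f y) ≡ does (g x ≟ g y)
same-kernel-on-pair {x = x} f g _ (inj₁ refl) (inj₁ refl) =
  trans (dec-true (f x ≟ f x) refl) (≡-sym (dec-true (g x ≟ g x) refl))
same-kernel-on-pair f g agree (inj₁ refl) (inj₂ refl) = agree
same-kernel-on-pair {s = s} {t} f g agree (inj₂ refl) (inj₁ refl) =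
  trans (≟-swap (f t) (f s)) (trans agree (≟-swap (g s) (g t)))
same-kernel-on-pair {x = x} f g _ (inj₂ refl) (inj₂ refl) =
  trans (dec-true (f x ≟ f x) refl) (≡-sym (dec-true (g x ≟ g x) refl))

disagree : ∀ {x y s : Bool} → x ≡ s → y ≡ not s → x ≢ y
disagree x≡s y≡¬s x≡y = not-¬ refl (trans (≡-sym x≡s) (trans x≡y y≡¬s))

count-mono : ∀ {n} {f g : Fin n → Bool} →
  (∀ i → f i ≡ true → g i ≡ true) → count f ≤ count g
count-mono {zero} _ = z≤n
count-mono {suc n} {f} {g} f⇒g with f zero in f₀ | g zero in g₀
... | true  | true  = s≤s (count-mono (f⇒g ∘ suc))
... | true  | false = contradiction (trans (≡-sym (f⇒g zero f₀)) g₀) λ ()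
... | false | _     = m≤n⇒m≤o+n _ (count-mono (f⇒g ∘ suc))

allB-mono : ∀ {n} {f g : Fin n → Bool} →
  (∀ i → f i ≡ true → g i ≡ true) → allB f ≡ true → allB g ≡ true
allB-mono {zero} _ _ = refl
allB-mono {suc n} {f} f⇒g all-f with f zero in f₀
... | true rewrite f⇒g zero f₀ = allB-mono (f⇒g ∘ suc) all-f

_without_ : ∀ {n} → (Fin n → Bool) → Fin n → Fin n → Bool
(f without i) j = not (does (j ≟ᶠ i)) ∧ f j

without-true : ∀ {n} {f : Fin n → Bool} {i j} →
  (f without i) j ≡ true → f j ≡ true × j ≢ i
without-true {f = f} {i} {j} h =
  ∧-conicalʳ _ (f j) h ,
  λ j≡i → contradiction
    (trans (cong not (≡-sym (dec-true (j ≟ᶠ i) j≡i))) (∧-conicalˡ _ (f j) h)) λ ()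

count-pick : ∀ {n m} (f : Fin n → Bool) → suc m ≤ count f →
  ∃ λ i → f i ≡ true × m ≤ count (f without i)
count-pick {suc n} f h with f zero in f₀
... | true  = zero , f₀ , s≤s⁻¹ h
... | false with count-pick (f ∘ suc) h
...   | i , fi , m≤ = suc i , fi , m≤n⇒m≤o+n _ m≤

record FourDistinct {n} (f : Fin n → Bool) : Set where
  field
    a b c d : Fin n
    fa : f a ≡ true
    fb : f b ≡ true
    fc : f c ≡ true
    fd : f d ≡ true
    b≢a : b ≢ a
    c≢a : c ≢ a
    c≢b : c ≢ b
    d≢a : d ≢ a
    d≢b : d ≢ b
    d≢c : d ≢ c

count≥4⇒FourDistinct : ∀ {n} (f : Fin n → Bool) → 4 ≤ count f → FourDistinct f
count≥4⇒FourDistinct f h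
  with a , fa  , h₁ ← count-pick f h
  with b , fb′ , h₂ ← count-pick (f without a) h₁
  with c , fc″ , h₃ ← count-pick ((f without a) without b) h₂
  with d , fd‴ , _  ← count-pick (((f without a) without b) without c) h₃
  with fb , b≢a ← without-true {f = f} fb′
  with fc′ , c≢b ← without-true {f = f without a} fc″
  with fc , c≢a ← without-true {f = f} fc′
  with fd″ , d≢c ← without-true {f = (f without a) without b} fd‴
  with fd′ , d≢b ← without-true {f = f without a} fd″
  with fd , d≢a ← without-true {f = f} fd′
  = record { a = a ; b = b ; c = c ; d = d ; fa = fa ; fb = fb ; fc = fc ; fd = fd
           ; b≢a = b≢a ; c≢a = c≢a ; c≢b = c≢b ; d≢a = d≢a ; d≢b = d≢b ; d≢c = d≢c }

module _ {n : ℕ} {G : Graph n} where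

  _refines_ : ISPartition G → ISPartition G → Set
  X refines Y = ∀ u w → same X u w ≡ true → same Y u w ≡ true

  refine : ISPartition G → (Fin n → ℕ) → ISPartition G
  refine P c = record
    { same       = λ u w → same P u w ∧ does (c u ≟ c w)
    ; same-refl  = λ v → cong₂ _∧_ (same-refl P v) (dec-true (c v ≟ c v) refl)
    ; same-sym   = λ u w → cong₂ _∧_ (same-sym P u w) (≟-swap (c u) (c w))
    ; same-trans = λ u v w h₁ h₂ → cong₂ _∧_
        (same-trans P u v w (∧-conicalˡ _ _ h₁) (∧-conicalˡ _ _ h₂))
        (dec-true (c u ≟ c w) (trans (does-true⇒ (c u ≟ c v) (∧-conicalʳ _ _ h₁))
                                     (does-true⇒ (c v ≟ c w) (∧-conicalʳ _ _ h₂))))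
    ; indep      = λ u w h → indep P u w (∧-conicalˡ _ _ h)
    }

  refine-refines : ∀ P c → refine P c refines P
  refine-refines P c u w = ∧-conicalˡ _ _

  numParts-refines : ∀ {X Y} → X refines Y → numParts Y ≤ numParts X
  numParts-refines {X} {Y} X⊑Y = count-mono λ v →
    allB-mono λ u → leader-test-antitone (u <ᵇF v) (X⊑Y u v)
    where
    leader-test-antitone : ∀ b {x y} → (x ≡ true → y ≡ true) →
      (if b then (if y then false else true) else true) ≡ true →
      (if b then (if x then false else true) else true) ≡ true
    leader-test-antitone false _ _ = refl
    leader-test-antitone true {false} _ _ = refl
    leader-test-antitone true {true} x⇒y h with x⇒y refl
    leader-test-antitone true {true} x⇒y () | refl

  BAdj-respˡ : ∀ {X X′ Y : ISPartition G} → X ≈P X′ → BAdj X Y → BAdj X′ Y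
  BAdj-respˡ X≈X′ (X≉Y , v , X-v≡Y-v) =
    (λ X′≈Y → X≉Y λ u w → trans (X≈X′ u w) (X′≈Y u w)) ,
    v , λ u w u≢v w≢v → trans (≡-sym (X≈X′ u w)) (X-v≡Y-v u w u≢v w≢v)

  ¬BAdj-at : ∀ {X Y : ISPartition G} {u₁ w₁ u₂ w₂} →
    u₁ ≢ u₂ → u₁ ≢ w₂ → w₁ ≢ u₂ → w₁ ≢ w₂ →
    same X u₁ w₁ ≢ same Y u₁ w₁ → same X u₂ w₂ ≢ same Y u₂ w₂ → ¬ BAdj X Y
  ¬BAdj-at {u₁ = u₁} {w₁} {u₂} {w₂} u₁≢u₂ u₁≢w₂ w₁≢u₂ w₁≢w₂ ne₁ ne₂ (_ , v , X-v≡Y-v)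
    with v ≟ᶠ u₁ | v ≟ᶠ w₁
  ... | yes refl | _ = ne₂ (X-v≡Y-v u₂ w₂ (≢-sym u₁≢u₂) (≢-sym u₁≢w₂))
  ... | no _ | yes refl = ne₂ (X-v≡Y-v u₂ w₂ (≢-sym w₁≢u₂) (≢-sym w₁≢w₂))
  ... | no v≢u₁ | no v≢w₁ = ne₁ (X-v≡Y-v u₁ w₁ (≢-sym v≢u₁) (≢-sym v≢w₁))

data Role : Set where
  first second rest : Role

module Split {n : ℕ} {G : Graph n} (P : ISPartition G) {a b : Fin n} (b≢a : b ≢ a) where

  role : Fin n → Role
  role u = if does (u ≟ᶠ a) then first else if does (u ≟ᶠ b) then second else rest

  role-a : role a ≡ first
  role-a rewrite dec-true (a ≟ᶠ a) refl = refl

  role-b : role b ≡ second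
  role-b rewrite dec-false (b ≟ᶠ a) b≢a | dec-true (b ≟ᶠ b) refl = refl

  role-rest : ∀ {u} → u ≢ a → u ≢ b → role u ≡ rest
  role-rest {u} u≢a u≢b rewrite dec-false (u ≟ᶠ a) u≢a | dec-false (u ≟ᶠ b) u≢b = refl

  role-off-a : ∀ {u} → u ≢ a → role u ≡ second ⊎ role u ≡ rest
  role-off-a {u} u≢a rewrite dec-false (u ≟ᶠ a) u≢a with does (u ≟ᶠ b)
  ... | true  = inj₁ refl
  ... | false = inj₂ refl

  role-off-b : ∀ {u} → u ≢ b → role u ≡ first ⊎ role u ≡ rest
  role-off-b {u} u≢b with does (u ≟ᶠ a)
  ... | true  = inj₁ refl
  ... | false rewrite dec-false (u ≟ᶠ b) u≢b = inj₂ refl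

  split : (Role → ℕ) → ISPartition G
  split κ = refine P (κ ∘ role)

  split-const : split (λ _ → 0) ≈P P
  split-const u w = ∧-identityʳ (same P u w)

  same-split : ∀ κ {u w r s} → same P u w ≡ true → role u ≡ r → role w ≡ s →
    same (split κ) u w ≡ does (κ r ≟ κ s)
  same-split κ {u} {w} Puw refl refl = cong (_∧ does (κ (role u) ≟ κ (role w))) Puw

  EqMinus-split : ∀ κ κ′ {v s t} → (∀ {u} → u ≢ v → role u ≡ s ⊎ role u ≡ t) →
    does (κ s ≟ κ t) ≡ does (κ′ s ≟ κ′ t) → EqMinus (split κ) (split κ′) v
  EqMinus-split κ κ′ roles agree u w u≢v w≢v =
    cong (same P u w ∧_) (same-kernel-on-pair κ κ′ agree (roles u≢v) (roles w≢v))

  BAdj-split : ∀ κ κ′ {x y s v r t} → same (split κ) x y ≡ s → same (split κ′) x y ≡ not s →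
    (∀ {u} → u ≢ v → role u ≡ r ⊎ role u ≡ t) → does (κ r ≟ κ t) ≡ does (κ′ r ≟ κ′ t) →
    BAdj (split κ) (split κ′)
  BAdj-split κ κ′ {x} {y} {v = v} xy≡s xy≡¬s roles agree =
    (λ eq → disagree xy≡s xy≡¬s (eq x y)) , v , EqMinus-split κ κ′ roles agree

module LargePart {n : ℕ} {G : Graph n} (InB : ISPartition G → Set)
  (InB-refines : ∀ {X Y : ISPartition G} → X refines Y → InB Y → InB X)
  (P : ISPartition G) (P∈B : InB P) {v : Fin n} (F : FourDistinct (same P v)) where

  open FourDistinct F
  open Split P b≢a

  same-P : ∀ {x y} → same P v x ≡ true → same P v y ≡ true → same P x y ≡ true
  same-P {x} {y} vx vy = same-trans P x v y (trans (same-sym P x v) vx) vy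

  at-ab : ∀ κ → same (split κ) a b ≡ does (κ first ≟ κ second)
  at-ab κ = same-split κ (same-P fa fb) role-a role-b

  at-ac : ∀ κ → same (split κ) a c ≡ does (κ first ≟ κ rest)
  at-ac κ = same-split κ (same-P fa fc) role-a (role-rest c≢a c≢b)

  at-bd : ∀ κ → same (split κ) b d ≡ does (κ second ≟ κ rest)
  at-bd κ = same-split κ (same-P fb fd) role-b (role-rest d≢a d≢b)

  split∈B : ∀ κ → InB (split κ)
  split∈B κ = InB-refines (refine-refines P (κ ∘ role)) P∈B

  ¬BAdj-at-ac-bd : ∀ (X Y : ISPartition G) →
    same X a c ≢ same Y a c → same X b d ≢ same Y b d → ¬ BAdj X Y
  ¬BAdj-at-ac-bd X Y = ¬BAdj-at {X = X} {Y} (≢-sym b≢a) (≢-sym d≢a) c≢b (≢-sym d≢c)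

  κ₀ κQ₁ κQ₂ κR₁ κR₂ : Role → ℕ
  κ₀ _ = 0
  κQ₁ first = 0
  κQ₁ _     = 1
  κQ₂ second = 0
  κQ₂ _      = 1
  κR₁ first  = 0
  κR₁ second = 1
  κR₁ rest   = 2
  κR₂ rest = 1
  κR₂ _    = 0

  Q₁ Q₂ R₁ R₂ : ISPartition G
  Q₁ = split κQ₁
  Q₂ = split κQ₂
  R₁ = split κR₁
  R₂ = split κR₂

  P—split : ∀ κ → BAdj (split κ₀) (split κ) → BAdj P (split κ)
  P—split κ = BAdj-respˡ {X = split κ₀} {P} {split κ} split-const

  P—Q₁ : BAdj P Q₁
  P—Q₁ = P—split κQ₁ (BAdj-split κ₀ κQ₁ (at-ab κ₀) (at-ab κQ₁) role-off-a refl)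

  P—Q₂ : BAdj P Q₂
  P—Q₂ = P—split κQ₂ (BAdj-split κ₀ κQ₂ (at-ab κ₀) (at-ab κQ₂) role-off-b refl)

  Q₁≉Q₂ : ¬ Q₁ ≈P Q₂
  Q₁≉Q₂ eq = disagree (at-ac κQ₁) (at-ac κQ₂) (eq a c)

  Q₁≁Q₂ : ¬ BAdj Q₁ Q₂
  Q₁≁Q₂ = ¬BAdj-at-ac-bd Q₁ Q₂
    (disagree (at-ac κQ₁) (at-ac κQ₂)) (disagree (at-bd κQ₁) (at-bd κQ₂))

  outside-N[P] : ∀ κ → does (κ first ≟ κ rest) ≡ false → does (κ second ≟ κ rest) ≡ false →
    ¬ split κ ≈P P × ¬ BAdj P (split κ)
  outside-N[P] κ a≁rest b≁rest =
    (λ eq → disagree (trans (at-ac κ) a≁rest) (same-P fa fc) (eq a c)) ,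
    ¬BAdj-at-ac-bd P (split κ) (disagree (same-P fa fc) (trans (at-ac κ) a≁rest))
                                   (disagree (same-P fb fd) (trans (at-bd κ) b≁rest))

  Q₁—R₁ : BAdj Q₁ R₁
  Q₁—R₁ = BAdj-split κQ₁ κR₁ (at-bd κQ₁) (at-bd κR₁) role-off-b refl

  Q₂—R₁ : BAdj Q₂ R₁
  Q₂—R₁ = BAdj-split κQ₂ κR₁ (at-ac κQ₂) (at-ac κR₁) role-off-a refl

  Q₁—R₂ : BAdj Q₁ R₂
  Q₁—R₂ = BAdj-split κQ₁ κR₂ (at-ab κQ₁) (at-ab κR₂) role-off-b refl

  Q₂—R₂ : BAdj Q₂ R₂
  Q₂—R₂ = BAdj-split κQ₂ κR₂ (at-ab κQ₂) (at-ab κR₂) role-off-a refl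

  ¬Property1 : ¬ Property1 InB P
  ¬Property1 prop
    with R , _ , _ , _ , _ , _ , unique , _ ←
      prop Q₁ Q₂ (split∈B κQ₁) (split∈B κQ₂) P—Q₁ P—Q₂ Q₁≉Q₂ Q₁≁Q₂
    with R₁≉P , P≁R₁ ← outside-N[P] κR₁ refl refl
    with R₂≉P , P≁R₂ ← outside-N[P] κR₂ refl refl
    = disagree (at-ab κR₁) (at-ab κR₂) (trans (R₁≈R a b) (≡-sym (R₂≈R a b)))
    where
    R₁≈R : R₁ ≈P R
    R₁≈R = unique R₁ (split∈B κR₁) R₁≉P P≁R₁ Q₁—R₁ Q₂—R₁
    R₂≈R : R₂ ≈P R
    R₂≈R = unique R₂ (split∈B κR₂) R₂≉P P≁R₂ Q₁—R₂ Q₂—R₂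

large-part⇒¬Property1 : ∀ {n} {G : Graph n} (InB : ISPartition G → Set) →
  (∀ {X Y : ISPartition G} → X refines Y → InB Y → InB X) →
  ∀ P → InB P → HasPartOfSize≥4 P → ¬ Property1 InB P
large-part⇒¬Property1 InB InB-refines P P∈B (v , large) =
  LargePart.¬Property1 InB InB-refines P P∈B (count≥4⇒FourDistinct (same P v) large)

lemma2p4 : ∀ (n : ℕ) (G : Graph n) →
    (∀ (P : ISPartition G) → HasPartOfSize≥4 P → ¬ Property1 InBAll P)
    × (∀ (k : ℕ) → k ≤ n ∸ 1 → ∀ (P : ISPartition G) → InB≥ k P →
         HasPartOfSize≥4 P → ¬ Property1 (InB≥ k) P)
lemma2p4 n G =
  (λ P → large-part⇒¬Property1 InBAll (λ _ _ → tt) P tt) ,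
  (λ k _ → large-part⇒¬Property1 (InB≥ k) λ {X} {Y} X⊑Y k≤Y →
     ≤-trans k≤Y (numParts-refines {X = X} {Y} X⊑Y))
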